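{- Let $n\ge r>i\ge 1$, $\ell\ge 1$ and $d_1,\ldots,d_\ell\ge 1$ be integers. Let $\mathcal{H}$ be an $n$-vertex $r$-graph and let $\mathcal{E}_1,\ldots,\mathcal{E}_\ell\subset\binom{V(\mathcal{H})}{i}$ be pairwise disjoint. Then there exists a subgraph $\mathcal{H}'\subset\mathcal{H}$ such that $\mathcal{E}_j$ is $d_j$-full in $\mathcal{H}'$ for every $j\in[\ell]$ and $$|\mathcal{H}'|\ge |\mathcal{H}|-\sum_{j\in[\ell]}(d_j-1)|\mathcal{E}_j|.$$
   Context: An $r$-graph is a collection of $r$-subsets (edges) of a finite vertex set; subgraphs are subsets of the edge set. For an $i$-set $T$, $d_{\mathcal{H}}(T)$ is the number of edges of $\mathcal{H}$ containing $T$. A set $\mathcal{E}\subset\binom{V(\mathcal{H})}{i}$ is $d$-full in $\mathcal{H}$ if for each $e\in\mathcal{E}$, either $d_{\mathcal{H}}(e)=0$ or $d_{\mathcal{H}}(e)\ge d$. -}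

module Defs where

open import Data.Nat using (ℕ; _≤_; _∸_; _*_; _+_)
open import Data.Fin using (Fin)
open import Data.Fin.Subset using (Subset; ∣_∣)
open import Data.Fin.Subset.Properties using (_⊆?_)
open import Data.List using (List; length; filter; map; allFin)
open import Data.Nat.ListAction using (sum)
open import Data.List.Membership.Propositional using (_∈_)
open import Data.List.Relation.Unary.Unique.Propositional using (Unique)
open import Data.Sum using (_⊎_)
open import Relation.Binary.PropositionalEquality using (_≡_)
open import Relation.Nullary using (¬_)

-- Vertex set V = Fin n.  A family of k-subsets of V (e.g. an r-graph, or a
-- subset of binom(V, i)) is a duplicate-free list of subsets of Fin n, each of
-- cardinality k.
IsUniformFamily : {n : ℕ} → ℕ → List (Subset n) → Set
IsUniformFamily k F = Unique F × (∀ {e} → e ∈ F → ∣ e ∣ ≡ k)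
  where open import Data.Product using (_×_)

∣_∣ₑ : {n : ℕ} → List (Subset n) → ℕ
∣ F ∣ₑ = length F

_⊑_ : {n : ℕ} → List (Subset n) → List (Subset n) → Set
H' ⊑ H = Unique H' × (∀ {e} → e ∈ H' → e ∈ H)
  where open import Data.Product using (_×_)

deg : {n : ℕ} → List (Subset n) → Subset n → ℕ
deg H T = length (filter (T ⊆?_) H)

Full : {n : ℕ} → ℕ → List (Subset n) → List (Subset n) → Set
Full d H E = ∀ {e} → e ∈ E → deg H e ≡ 0 ⊎ d ≤ deg H e

Disjoint : {n : ℕ} → List (Subset n) → List (Subset n) → Set
Disjoint A B = ∀ {e} → e ∈ A → ¬ (e ∈ B)

Σ[_] : (ℓ : ℕ) → (Fin ℓ → ℕ) → ℕ
Σ[ ℓ ] f = sum (map f (allFin ℓ))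

module Submission where

-- Proof idea: while some i-set T ∈ 𝓔ⱼ has 0 < d(T) < dⱼ, delete every edge
-- containing T.  This costs d(T) ≤ dⱼ − 1 edges and leaves d(T) = 0, which no
-- later deletion can undo, so each T is charged at most once.

open import Defs
open import Data.Nat using (ℕ; _≤_; _<_; _∸_; _*_; _+_)
open import Data.Fin using (Fin)
open import Data.Fin.Subset using (Subset)
open import Data.List using (List)
open import Data.Product using (Σ; _×_)
open import Relation.Binary.PropositionalEquality using (_≢_)

open import Data.Nat using (zero; suc; z≤n)
open import Data.Nat.Properties
  using (_≟_; _≤?_; ≤-trans; ≤-reflexive; ≤-pred; ≰⇒>; m≤m+n; +-suc; +-mono-≤; *-zeroʳ; *-suc
        ; +-commutativeSemigroup; module ≤-Reasoning)
open import Data.Nat.Induction using (<-wellFounded)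
open import Data.Nat.ListAction using (sum)
open import Data.Nat.ListAction.Properties using (sum-++; sum-↭)
open import Data.Fin.Subset using (_⊆_)
open import Data.Fin.Subset.Properties using (_⊆?_)
open import Data.List using ([]; _∷_; _++_; map; filter; length; concatMap; allFin)
open import Data.List.Properties using (map-++; map-cong; filter-none)
open import Data.List.Membership.Propositional using (_∈_; find; lose)
open import Data.List.Membership.Propositional.Properties
  using (∈-map⁺; ∈-filter⁻; ∈-allFin; ∈-concatMap⁺; ∈-∃++)
open import Data.List.Relation.Unary.All as All using (All; all?; _∷_)
open import Data.List.Relation.Unary.All.Properties using (¬All⇒Any¬)
open import Data.List.Relation.Unary.Unique.Propositional using (Unique)
import Data.List.Relation.Unary.Unique.Propositional.Properties as Unique
open import Data.List.Relation.Binary.Permutation.Propositional using (_↭_; ↭-sym)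
import Data.List.Relation.Binary.Permutation.Propositional.Properties as ↭
open import Data.Product using (_,_; proj₁; proj₂; ∃)
open import Data.Sum using (_⊎_; inj₁; inj₂)
open import Function using (_∘_; id)
open import Induction.WellFounded using (Acc; acc)
open import Relation.Nullary using (¬_; yes; no; contradiction)
open import Relation.Nullary.Decidable using (¬?; _⊎-dec_)
open import Relation.Unary using (Pred; Decidable)
open import Relation.Binary.PropositionalEquality using (_≡_; refl; sym; trans; cong; module ≡-Reasoning)
open import Algebra.Properties.CommutativeSemigroup +-commutativeSemigroup using (x∙yz≈y∙xz)

module _ {a p} {A : Set a} {P : Pred A p} (P? : Decidable P) where

  length-filter+filter¬ : ∀ xs → length (filter P? xs) + length (filter (¬? ∘ P?) xs) ≡ length xs
  length-filter+filter¬ [] = refl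
  length-filter+filter¬ (x ∷ xs) with P? x
  ... | yes _ = cong suc (length-filter+filter¬ xs)
  ... | no _ = trans (+-suc _ _) (cong suc (length-filter+filter¬ xs))

∈⇒↭∷ : ∀ {a} {A : Set a} {x : A} {xs} → x ∈ xs → ∃ λ ys → xs ↭ x ∷ ys
∈⇒↭∷ x∈xs with ys , zs , refl ← ∈-∃++ x∈xs = ys ++ zs , ↭.shift _ ys zs

module _ {n : ℕ} where

  Requirement : Set
  Requirement = Subset n × ℕ

  Satisfies : List (Subset n) → Requirement → Set
  Satisfies G (T , d) = deg G T ≡ 0 ⊎ d ≤ deg G T

  satisfies? : ∀ G → Decidable (Satisfies G)
  satisfies? G (T , d) = (deg G T ≟ 0) ⊎-dec (d ≤? deg G T)

  slack : Requirement → ℕ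
  slack (_ , d) = d ∸ 1

  budget : List Requirement → ℕ
  budget = sum ∘ map slack

  unsatisfied⇒deg≤slack : ∀ {G T} d → ¬ Satisfies G (T , d) → deg G T ≤ d ∸ 1
  unsatisfied⇒deg≤slack zero unsat = contradiction (inj₂ z≤n) unsat
  unsatisfied⇒deg≤slack {G} {T} (suc d) unsat with suc d ≤? deg G T
  ... | yes d<deg = contradiction (inj₂ d<deg) unsat
  ... | no d≮deg = ≤-pred (≰⇒> d≮deg)

  dropSupersets : Subset n → List (Subset n) → List (Subset n)
  dropSupersets T = filter (¬? ∘ (T ⊆?_))

  length≡deg+dropSupersets : ∀ T G → length G ≡ deg G T + length (dropSupersets T G)
  length≡deg+dropSupersets T G = sym (length-filter+filter¬ (T ⊆?_) G)

  deg≡0 : ∀ {T : Subset n} {H} → All (λ e → ¬ T ⊆ e) H → deg H T ≡ 0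
  deg≡0 {T} {H} none = cong length (filter-none (T ⊆?_) {H} none)

  record Pruning (G : List (Subset n)) (P : List Requirement) : Set where
    constructor pruned
    field
      graph : List (Subset n)
      graph⊑G : graph ⊑ G
      satisfied : All (Satisfies graph) P
      size : length G ≤ length graph + budget P

  Pruning-resp-↭ : ∀ {G P Q} → P ↭ Q → Pruning G P → Pruning G Q
  Pruning-resp-↭ P↭Q (pruned H H⊑G sat size) =
    pruned H H⊑G (↭.All-resp-↭ P↭Q sat)
      (≤-trans size (≤-reflexive (cong (length H +_) (sum-↭ (↭.map⁺ slack P↭Q)))))

  pruneSatisfied : ∀ {G P} → Unique G → All (Satisfies G) P → Pruning G P
  pruneSatisfied {G} {P} uG sat = pruned G (uG , id) sat (m≤m+n (length G) (budget P))

  pruneUnsatisfied : ∀ {G T d P} → ¬ Satisfies G (T , d) →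
    Pruning (dropSupersets T G) P → Pruning G ((T , d) ∷ P)
  pruneUnsatisfied {G} {T} {d} {P} unsat (pruned H (uH , H⊆G′) sat size) =
    pruned H (uH , proj₁ ∘ dropped ∘ H⊆G′) (inj₁ T∉H ∷ sat) size′
    where
      dropped : ∀ {e} → e ∈ dropSupersets T G → e ∈ G × ¬ T ⊆ e
      dropped = ∈-filter⁻ (¬? ∘ (T ⊆?_))

      T∉H : deg H T ≡ 0
      T∉H = deg≡0 (All.tabulate (proj₂ ∘ dropped ∘ H⊆G′))

      size′ : length G ≤ length H + (d ∸ 1 + budget P)
      size′ = begin
        length G                              ≡⟨ length≡deg+dropSupersets T G ⟩
        deg G T + length (dropSupersets T G)  ≤⟨ +-mono-≤ (unsatisfied⇒deg≤slack {G} {T} d unsat) size ⟩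
        d ∸ 1 + (length H + budget P)         ≡⟨ x∙yz≈y∙xz (d ∸ 1) (length H) (budget P) ⟩
        length H + (d ∸ 1 + budget P)         ∎
        where open ≤-Reasoning

  prune : ∀ G P → Unique G → Acc _<_ (length P) → Pruning G P
  prune G P uG (acc rec) with all? (satisfies? G) P
  ... | yes sat = pruneSatisfied uG sat
  ... | no ¬sat
    with (T , d) , p∈P , unsat ← find (¬All⇒Any¬ (satisfies? G) P ¬sat)
    with Q , P↭p∷Q ← ∈⇒↭∷ p∈P =
    Pruning-resp-↭ (↭-sym P↭p∷Q) (pruneUnsatisfied unsat pruneRest)
    where
      Q<P : length Q < length P
      Q<P = ≤-reflexive (sym (↭.↭-length P↭p∷Q))

      pruneRest : Pruning (dropSupersets T G) Q
      pruneRest = prune (dropSupersets T G) Q (Unique.filter⁺ _ uG) (rec Q<P)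

  requirements : ∀ {ℓ} → (Fin ℓ → ℕ) → (Fin ℓ → List (Subset n)) → List Requirement
  requirements {ℓ} d E = concatMap (λ j → map (_, d j) (E j)) (allFin ℓ)

  budget-concatMap : ∀ {a} {A : Set a} (f : A → List Requirement) xs →
    budget (concatMap f xs) ≡ sum (map (budget ∘ f) xs)
  budget-concatMap f [] = refl
  budget-concatMap f (x ∷ xs) = begin
    sum (map slack (f x ++ concatMap f xs))              ≡⟨ cong sum (map-++ slack (f x) _) ⟩
    sum (map slack (f x) ++ map slack (concatMap f xs))  ≡⟨ sum-++ (map slack (f x)) _ ⟩
    budget (f x) + budget (concatMap f xs)               ≡⟨ cong (budget (f x) +_) (budget-concatMap f xs) ⟩
    budget (f x) + sum (map (budget ∘ f) xs)             ∎
    where open ≡-Reasoning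

  budget-sameThreshold : ∀ d (E : List (Subset n)) → budget (map (_, d) E) ≡ (d ∸ 1) * length E
  budget-sameThreshold d [] = sym (*-zeroʳ (d ∸ 1))
  budget-sameThreshold d (e ∷ E) =
    trans (cong (d ∸ 1 +_) (budget-sameThreshold d E)) (sym (*-suc (d ∸ 1) (length E)))

  budget-requirements : ∀ {ℓ} (d : Fin ℓ → ℕ) E →
    budget (requirements d E) ≡ Σ[ ℓ ] (λ j → (d j ∸ 1) * ∣ E j ∣ₑ)
  budget-requirements {ℓ} d E =
    trans (budget-concatMap _ (allFin ℓ))
      (cong sum (map-cong (λ j → budget-sameThreshold (d j) (E j)) (allFin ℓ)))

  satisfied⇒Full : ∀ {ℓ} G (d : Fin ℓ → ℕ) E →
    All (Satisfies G) (requirements d E) → ∀ j → Full (d j) G (E j)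
  satisfied⇒Full G d E sat j e∈Ej =
    All.lookup sat
      (∈-concatMap⁺ (λ j → map (_, d j) (E j)) (lose (∈-allFin j) (∈-map⁺ (_, d j) e∈Ej)))

lemma5p1 : (n r i ℓ : ℕ) → r ≤ n → i < r → 1 ≤ i → 1 ≤ ℓ →
    (d : Fin ℓ → ℕ) → (∀ j → 1 ≤ d j) →
    (H : List (Subset n)) → IsUniformFamily r H →
    (E : Fin ℓ → List (Subset n)) → (∀ j → IsUniformFamily i (E j)) →
    (∀ j k → j ≢ k → Disjoint (E j) (E k)) →
    Σ (List (Subset n)) (λ H' → H' ⊑ H × (∀ j → Full (d j) H' (E j))
    × ∣ H ∣ₑ ≤ ∣ H' ∣ₑ + Σ[ ℓ ] (λ j → (d j ∸ 1) * ∣ E j ∣ₑ))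
lemma5p1 n r i ℓ _ _ _ _ d _ H (uH , _) E _ _ =
  graph , graph⊑G , satisfied⇒Full graph d E satisfied ,
  ≤-trans size (≤-reflexive (cong (length graph +_) (budget-requirements d E)))
  where open Pruning (prune H (requirements d E) uH (<-wellFounded _))
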